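{- Let $R$ be a commutative ring with identity and $n\ge 2$. Let $w_0,\dots,w_{n-1}\in R$ and let $W=(d_{ij})_{0\le i,j\le n-1}$ where $d_{ii}=0$ and for $i\ne j$, $d_{ij}=\sum_{k=0}^{m-1}w_{i+k}$ (indices mod $n$) with $m\in\{1,\dots,n-1\}$, $m\equiv j-i\pmod n$; i.e. $W$ is the distance matrix of the weighted directed cycle on vertices $0,\dots,n-1$ with arc $(i,i+1)$ of weight $w_i$. Let $w=\sum_{i=0}^{n-1}w_i$ and $w^{(2)}=\sum_{0\le i<j\le n-1}w_iw_j$, and suppose $w$ is invertible in $R$. Then $$\det(W)=(-1)^{n-1}w^{n-2}w^{(2)}.$$ -}

module Defs where

open import Level using (Level)
open import Data.Nat using (ℕ; zero; suc; NonZero) renaming (_+_ to _+ℕ_; _∸_ to _∸ℕ_)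
open import Data.Nat.DivMod using (_mod_)
open import Data.Fin using (Fin; toℕ; punchIn) renaming (zero to fzero; suc to fsuc)
open import Data.Product using (∃)
open import Algebra.Bundles using (CommutativeRing)

module _ {c ℓ : Level} (R : CommutativeRing c ℓ) where
  open CommutativeRing R

  pow : Carrier → ℕ → Carrier
  pow x zero    = 1#
  pow x (suc k) = x * pow x k

  sumℕ : ℕ → (ℕ → Carrier) → Carrier
  sumℕ zero    f = 0#
  sumℕ (suc m) f = sumℕ m f + f m

  sumFin : (n : ℕ) → (Fin n → Carrier) → Carrier
  sumFin zero    f = 0#
  sumFin (suc n) f = f fzero + sumFin n (λ i → f (fsuc i))

  det : (n : ℕ) → (Fin n → Fin n → Carrier) → Carrier
  det zero    M = 1#
  det (suc n) M = sumFin (suc n) (λ i →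
    pow (- 1#) (toℕ i) * (M i fzero * det n (λ r s → M (punchIn i r) (fsuc s))))

  isUnit : Carrier → Set (c Level.⊔ ℓ)
  isUnit x = ∃ λ y → x * y ≈ 1#

  -- distance matrix of the weighted directed cycle 0 → 1 → … → n-1 → 0,
  -- arc (i,i+1 mod n) of weight w i:
  -- d i j = Σ_{k=0}^{m-1} w_{(i+k) mod n}, where m ∈ {0,…,n-1}, m ≡ j - i (mod n)
  -- (so m = 0 exactly when i = j, giving d i i = 0).
  cycleDist : (n : ℕ) .{{_ : NonZero n}} → (Fin n → Carrier) → Fin n → Fin n → Carrier
  cycleDist n w i j =
    sumℕ (toℕ ((toℕ j +ℕ (n ∸ℕ toℕ i)) mod n)) (λ k → w ((toℕ i +ℕ k) mod n))

  totalWeight : (n : ℕ) → (Fin n → Carrier) → Carrier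
  totalWeight n w = sumFin n w

  secondSym : (n : ℕ) .{{_ : NonZero n}} → (Fin n → Carrier) → Carrier
  secondSym n w = sumℕ n (λ j → sumℕ j (λ i → w (i mod n) * w (j mod n)))

module Submission where

-- Subtracting each row of the distance matrix from the next one turns row i+1 into
-- w·eᵢ − wᵢ·𝟙, because d_{i+1,j} − d_{i,j} = −wᵢ except at j = i, where the cycle closes
-- and the difference is w − wᵢ. The first row is s = (w₀ + … + w_{j−1})ⱼ. In the new
-- matrix the vector w·s − w⁽²⁾·𝟙 is a combination of rows 1, …, n−1 (with coefficients
-- s_k − s_{n−1}), so linearity in the first row gives w·det W = w⁽²⁾·det M, where M has
-- first row 𝟙 and the same other rows. Adding wᵢ times the first row of M to row i+1
-- leaves 𝟙 above w·I, whose determinant is (−w)^{n−1}; cancelling the unit w finishes.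

open import Defs
open import Level using (Level)
open import Data.Nat as ℕ using (ℕ; zero; suc; z≤n; s≤s; z<s; _≤_; _<_; _∸_; NonZero; _≟_; _≤?_)
import Data.Nat.Properties as ℕₚ
open import Data.Nat.DivMod using (_mod_; _%_; [m+n]%n≡m%n; m<n⇒m%n≡m)
open import Data.Fin as Fin using (Fin)
import Data.Fin.Properties as Finₚ
open import Algebra.Bundles using (CommutativeRing)
open import Data.Product.Base using (_,_)
open import Data.Sum.Base using (inj₁; inj₂)
open import Function.Base using (_∘_)
open import Relation.Binary.Definitions using (tri<; tri≈; tri>)
open import Relation.Binary.PropositionalEquality as ≡ using (_≡_; _≢_)
open import Relation.Nullary using (yes; no; contradiction)

module CyclicSteps (p : ℕ) where
  open ≡.≡-Reasoning

  n : ℕ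
  n = suc p

  steps : ℕ → ℕ → ℕ
  steps i j = Fin.toℕ ((j ℕ.+ (n ∸ i)) mod n)

  toℕ-mod : ∀ m → Fin.toℕ (m mod n) ≡ m % n
  toℕ-mod m = Finₚ.toℕ-fromℕ< _

  toℕ-mod-< : ∀ {m} → m < n → Fin.toℕ (m mod n) ≡ m
  toℕ-mod-< {m} m<n = ≡.trans (toℕ-mod m) (m<n⇒m%n≡m m<n)

  mod-periodic : ∀ i → (i ℕ.+ n) mod n ≡ i mod n
  mod-periodic i = Finₚ.toℕ-injective (begin
    Fin.toℕ ((i ℕ.+ n) mod n) ≡⟨ toℕ-mod (i ℕ.+ n) ⟩
    (i ℕ.+ n) % n             ≡⟨ [m+n]%n≡m%n i n ⟩
    i % n                     ≡⟨ toℕ-mod i ⟨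
    Fin.toℕ (i mod n)         ∎)

  ∸-suc : ∀ {i j} → i < j → j ∸ i ≡ suc (j ∸ suc i)
  ∸-suc {zero}  {suc j} _         = ≡.refl
  ∸-suc {suc i} {suc j} (s≤s i<j) = ∸-suc i<j

  steps-≤ : ∀ {i j} → i ≤ j → j < n → steps i j ≡ j ∸ i
  steps-≤ {i} {j} i≤j j<n = begin
    Fin.toℕ ((j ℕ.+ (n ∸ i)) mod n)   ≡⟨ ≡.cong (λ m → Fin.toℕ (m mod n)) j+[n∸i]≡[j∸i]+n ⟩
    Fin.toℕ (((j ∸ i) ℕ.+ n) mod n)  ≡⟨ ≡.cong Fin.toℕ (mod-periodic (j ∸ i)) ⟩
    Fin.toℕ ((j ∸ i) mod n)          ≡⟨ toℕ-mod-< (ℕₚ.≤-<-trans (ℕₚ.m∸n≤m j i) j<n) ⟩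
    j ∸ i                            ∎
    where
    j+[n∸i]≡[j∸i]+n : j ℕ.+ (n ∸ i) ≡ (j ∸ i) ℕ.+ n
    j+[n∸i]≡[j∸i]+n = begin
      j ℕ.+ (n ∸ i)               ≡⟨ ≡.cong (ℕ._+ (n ∸ i)) (ℕₚ.m∸n+n≡m i≤j) ⟨
      (j ∸ i) ℕ.+ i ℕ.+ (n ∸ i)   ≡⟨ ℕₚ.+-assoc (j ∸ i) i (n ∸ i) ⟩
      (j ∸ i) ℕ.+ (i ℕ.+ (n ∸ i)) ≡⟨ ≡.cong ((j ∸ i) ℕ.+_) (ℕₚ.m+[n∸m]≡n (ℕₚ.≤-trans i≤j (ℕₚ.<⇒≤ j<n))) ⟩
      (j ∸ i) ℕ.+ n               ∎

  steps-> : ∀ {i j} → j < i → i < n → steps i j ≡ j ℕ.+ (n ∸ i)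
  steps-> {i} {j} j<i i<n =
    toℕ-mod-< (≡.subst (j ℕ.+ (n ∸ i) <_) (ℕₚ.m+[n∸m]≡n (ℕₚ.<⇒≤ i<n)) (ℕₚ.+-monoˡ-< (n ∸ i) j<i))

  steps-suc : ∀ {i j} → suc i < n → j < n → j ≢ i → steps i j ≡ suc (steps (suc i) j)
  steps-suc {i} {j} 1+i<n j<n j≢i with ℕₚ.<-cmp i j
  ... | tri< i<j _ _ = begin
    steps i j              ≡⟨ steps-≤ (ℕₚ.<⇒≤ i<j) j<n ⟩
    j ∸ i                  ≡⟨ ∸-suc i<j ⟩
    suc (j ∸ suc i)        ≡⟨ ≡.cong suc (steps-≤ i<j j<n) ⟨
    suc (steps (suc i) j)  ∎
  ... | tri≈ _ i≡j _ = contradiction (≡.sym i≡j) j≢i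
  ... | tri> _ _ j<i = begin
    steps i j                   ≡⟨ steps-> j<i i<n ⟩
    j ℕ.+ (n ∸ i)               ≡⟨ ≡.cong (j ℕ.+_) (∸-suc i<n) ⟩
    j ℕ.+ suc (n ∸ suc i)       ≡⟨ ℕₚ.+-suc j (n ∸ suc i) ⟩
    suc (j ℕ.+ (n ∸ suc i))     ≡⟨ ≡.cong suc (steps-> (ℕₚ.m<n⇒m<1+n j<i) 1+i<n) ⟨
    suc (steps (suc i) j)       ∎
    where
    i<n : i < n
    i<n = ℕₚ.<-trans (ℕₚ.n<1+n i) 1+i<n

  steps-diag : ∀ {i} → i < n → steps i i ≡ 0
  steps-diag {i} i<n = ≡.trans (steps-≤ ℕₚ.≤-refl i<n) (ℕₚ.n∸n≡0 i)

  steps-from-0 : ∀ {j} → j < n → steps 0 j ≡ j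
  steps-from-0 j<n = steps-≤ z≤n j<n

  steps-back : ∀ {i} → suc i < n → steps (suc i) i ≡ p
  steps-back {i} 1+i<n = ≡.trans (steps-> ℕₚ.≤-refl 1+i<n) (ℕₚ.m+[n∸m]≡n (ℕₚ.<⇒≤ (ℕₚ.≤-pred 1+i<n)))

module CycleDeterminant {ℓ₁ ℓ₂ : Level} (R : CommutativeRing ℓ₁ ℓ₂) where
  open CommutativeRing R hiding (zero)
  open import Algebra.Properties.Ring ring
    using ( -1*x≈-x; -‿distribˡ-*; -‿involutive; -‿injective; -0#≈0#; -‿+-comm
          ; +-inverseˡ-unique; +-cancelʳ; x≈z//y; x[y-z]≈xy-xz; [y-z]x≈yx-zx )
  open import Algebra.Properties.CommutativeSemigroup *-commutativeSemigroup using (x∙yz≈y∙xz)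
  open import Algebra.Properties.CommutativeSemigroup +-commutativeSemigroup
    using (interchange) renaming (x∙yz≈y∙xz to x+[y+z]≈y+[x+z])
  open import Relation.Binary.Reasoning.Setoid setoid

  *-linear : ∀ x a b u v → x * (a * u + b * v) ≈ a * (x * u) + b * (x * v)
  *-linear x a b u v = trans (distribˡ x _ _) (+-cong (x∙yz≈y∙xz x a u) (x∙yz≈y∙xz x b v))

  *-linearʳ : ∀ a b u v x → (a * u + b * v) * x ≈ a * (u * x) + b * (v * x)
  *-linearʳ a b u v x = trans (distribʳ x _ _) (+-cong (*-assoc a u x) (*-assoc b v x))

  y-[x+y]≈-x : ∀ x y → y - (x + y) ≈ - x
  y-[x+y]≈-x x y = begin
    y + - (x + y)    ≈⟨ +-congˡ (-‿+-comm x y) ⟨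
    y + (- x + - y)  ≈⟨ x+[y+z]≈y+[x+z] y (- x) (- y) ⟩
    - x + (y - y)    ≈⟨ +-congˡ (-‿inverseʳ y) ⟩
    - x + 0#         ≈⟨ +-identityʳ (- x) ⟩
    - x              ∎

  [x-y]+y≈x : ∀ x y → (x - y) + y ≈ x
  [x-y]+y≈x x y = trans (+-assoc x (- y) y) (trans (+-congˡ (-‿inverseˡ y)) (+-identityʳ x))

  x[t-s]-[a-s²]≈xt-[a+su] : ∀ {x s u} t a → x ≈ s + u → x * (t - s) - (a - s * s) ≈ x * t - (a + s * u)
  x[t-s]-[a-s²]≈xt-[a+su] {x} {s} {u} t a x≈s+u = begin
    x * (t - s) - (a - s * s)         ≈⟨ +-congʳ (x[y-z]≈xy-xz x t s) ⟩
    (x * t - x * s) - (a - s * s)     ≈⟨ +-assoc (x * t) (- (x * s)) _ ⟩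
    x * t + (- (x * s) - (a - s * s)) ≈⟨ +-congˡ (-‿+-comm (x * s) (a - s * s)) ⟩
    x * t - (x * s + (a - s * s))     ≈⟨ +-congˡ (-‿cong xs+[a-s²]≈a+su) ⟩
    x * t - (a + s * u)               ∎
    where
    xs+[a-s²]≈a+su : x * s + (a - s * s) ≈ a + s * u
    xs+[a-s²]≈a+su = begin
      x * s + (a - s * s)               ≈⟨ +-congʳ (trans (*-comm x s) (trans (*-congˡ x≈s+u) (distribˡ s s u))) ⟩
      (s * s + s * u) + (a - s * s)     ≈⟨ +-comm _ _ ⟩
      (a - s * s) + (s * s + s * u)     ≈⟨ +-assoc a (- (s * s)) _ ⟩
      a + (- (s * s) + (s * s + s * u)) ≈⟨ +-congˡ (+-assoc _ _ _) ⟨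
      a + ((- (s * s) + s * s) + s * u) ≈⟨ +-congˡ (+-congʳ (-‿inverseˡ (s * s))) ⟩
      a + (0# + s * u)                  ≈⟨ +-congˡ (+-identityˡ _) ⟩
      a + s * u                         ∎

  pow-neg : ∀ x k → pow R (- x) k ≈ pow R (- 1#) k * pow R x k
  pow-neg x zero    = sym (*-identityˡ 1#)
  pow-neg x (suc k) = begin
    - x * pow R (- x) k                          ≈⟨ *-cong (sym (-1*x≈-x x)) (pow-neg x k) ⟩
    (- 1# * x) * (pow R (- 1#) k * pow R x k)    ≈⟨ *-assoc _ _ _ ⟩
    - 1# * (x * (pow R (- 1#) k * pow R x k))    ≈⟨ *-congˡ (x∙yz≈y∙xz _ _ _) ⟩
    - 1# * (pow R (- 1#) k * (x * pow R x k))    ≈⟨ *-assoc _ _ _ ⟨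
    (- 1# * pow R (- 1#) k) * (x * pow R x k)    ∎

  unit-cancelˡ : ∀ {x a b} → isUnit R x → x * a ≈ x * b → a ≈ b
  unit-cancelˡ {x} {a} {b} (y , x*y≈1) x*a≈x*b = begin
    a            ≈⟨ y*[x*z]≈z a ⟨
    y * (x * a)  ≈⟨ *-congˡ x*a≈x*b ⟩
    y * (x * b)  ≈⟨ y*[x*z]≈z b ⟩
    b            ∎
    where
    y*[x*z]≈z : ∀ z → y * (x * z) ≈ z
    y*[x*z]≈z z = trans (sym (*-assoc y x z)) (trans (*-congʳ (trans (*-comm y x) x*y≈1)) (*-identityˡ z))

  -- Finite sums

  Row : Set ℓ₁
  Row = ℕ → Carrier

  ∑ : ℕ → Row → Carrier
  ∑ = sumℕ R

  ∑-cong : ∀ m {f g : Row} → (∀ k → k < m → f k ≈ g k) → ∑ m f ≈ ∑ m g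
  ∑-cong zero    f≈g = refl
  ∑-cong (suc m) f≈g = +-cong (∑-cong m (λ k k<m → f≈g k (ℕₚ.m<n⇒m<1+n k<m))) (f≈g m ℕₚ.≤-refl)

  ∑-zero : ∀ m {f : Row} → (∀ k → k < m → f k ≈ 0#) → ∑ m f ≈ 0#
  ∑-zero zero    f≈0 = refl
  ∑-zero (suc m) f≈0 =
    trans (+-cong (∑-zero m (λ k k<m → f≈0 k (ℕₚ.m<n⇒m<1+n k<m))) (f≈0 m ℕₚ.≤-refl)) (+-identityˡ 0#)

  ∑-distrib-+ : ∀ m (f g : Row) → ∑ m (λ k → f k + g k) ≈ ∑ m f + ∑ m g
  ∑-distrib-+ zero    f g = sym (+-identityˡ 0#)
  ∑-distrib-+ (suc m) f g = trans (+-congʳ (∑-distrib-+ m f g)) (interchange _ _ _ _)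

  *-distribˡ-∑ : ∀ m a (f : Row) → a * ∑ m f ≈ ∑ m (λ k → a * f k)
  *-distribˡ-∑ zero    a f = zeroʳ a
  *-distribˡ-∑ (suc m) a f = trans (distribˡ a _ _) (+-congʳ (*-distribˡ-∑ m a f))

  *-distribʳ-∑ : ∀ m a (f : Row) → ∑ m f * a ≈ ∑ m (λ k → f k * a)
  *-distribʳ-∑ zero    a f = zeroˡ a
  *-distribʳ-∑ (suc m) a f = trans (distribʳ a _ _) (+-congʳ (*-distribʳ-∑ m a f))

  -‿distrib-∑ : ∀ m (f : Row) → - ∑ m f ≈ ∑ m (λ k → - f k)
  -‿distrib-∑ zero    f = -0#≈0#
  -‿distrib-∑ (suc m) f = trans (sym (-‿+-comm _ _)) (+-congʳ (-‿distrib-∑ m f))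

  ∑-linear : ∀ m a b {f g h : Row} → (∀ k → k < m → h k ≈ a * f k + b * g k) →
             ∑ m h ≈ a * ∑ m f + b * ∑ m g
  ∑-linear m a b {f} {g} {h} h≈ = begin
    ∑ m h                                     ≈⟨ ∑-cong m h≈ ⟩
    ∑ m (λ k → a * f k + b * g k)             ≈⟨ ∑-distrib-+ m _ _ ⟩
    ∑ m (λ k → a * f k) + ∑ m (λ k → b * g k) ≈⟨ +-cong (*-distribˡ-∑ m a f) (*-distribˡ-∑ m b g) ⟨
    a * ∑ m f + b * ∑ m g                     ∎

  ∑-front : ∀ m (f : Row) → ∑ (suc m) f ≈ f 0 + ∑ m (f ∘ suc)
  ∑-front zero    f = trans (+-identityˡ _) (sym (+-identityʳ _))
  ∑-front (suc m) f = trans (+-congʳ (∑-front m f)) (+-assoc _ _ _)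

  ∑-shift-periodic : ∀ m (f : Row) → f m ≈ f 0 → ∑ m (f ∘ suc) ≈ ∑ m f
  ∑-shift-periodic m f fm≈f0 = +-cancelʳ (f 0) _ _ (begin
    ∑ m (f ∘ suc) + f 0 ≈⟨ +-comm _ _ ⟩
    f 0 + ∑ m (f ∘ suc) ≈⟨ ∑-front m f ⟨
    ∑ m f + f m         ≈⟨ +-congˡ fm≈f0 ⟩
    ∑ m f + f 0         ∎)

  ∑-single : ∀ m k {f : Row} → k < m → (∀ i → i < m → i ≢ k → f i ≈ 0#) → ∑ m f ≈ f k
  ∑-single (suc m) k k<1+m f≈0 with ℕₚ.m<1+n⇒m<n∨m≡n k<1+m
  ... | inj₁ k<m =
    trans (+-cong (∑-single m k k<m (λ i i<m → f≈0 i (ℕₚ.m<n⇒m<1+n i<m)))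
                  (f≈0 m ℕₚ.≤-refl (ℕₚ.<⇒≢ k<m ∘ ≡.sym)))
          (+-identityʳ _)
  ... | inj₂ ≡.refl =
    trans (+-congʳ (∑-zero k (λ i i<k → f≈0 i (ℕₚ.m<n⇒m<1+n i<k) (ℕₚ.<⇒≢ i<k)))) (+-identityˡ _)

  ∑-cancelling-pair : ∀ m k {f : Row} → suc k < m →
    (∀ i → i < m → i ≢ k → i ≢ suc k → f i ≈ 0#) → f k + f (suc k) ≈ 0# → ∑ m f ≈ 0#
  ∑-cancelling-pair (suc m) k {f} 1+k<1+m f≈0 pair≈0 with ℕₚ.m<1+n⇒m<n∨m≡n 1+k<1+m
  ... | inj₁ 1+k<m =
    trans (+-cong (∑-cancelling-pair m k 1+k<m (λ i i<m → f≈0 i (ℕₚ.m<n⇒m<1+n i<m)) pair≈0)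
                  (f≈0 m ℕₚ.≤-refl (ℕₚ.<⇒≢ (ℕₚ.<-trans (ℕₚ.n<1+n k) 1+k<m) ∘ ≡.sym) (ℕₚ.<⇒≢ 1+k<m ∘ ≡.sym)))
          (+-identityˡ 0#)
  ... | inj₂ ≡.refl = begin
    (∑ k f + f k) + f (suc k) ≈⟨ +-assoc _ _ _ ⟩
    ∑ k f + (f k + f (suc k)) ≈⟨ +-cong (∑-zero k below-k) pair≈0 ⟩
    0# + 0#                   ≈⟨ +-identityˡ 0# ⟩
    0#                        ∎
    where
    below-k : ∀ i → i < k → f i ≈ 0#
    below-k i i<k = f≈0 i (ℕₚ.m<n⇒m<1+n (ℕₚ.m<n⇒m<1+n i<k)) (ℕₚ.<⇒≢ i<k) (ℕₚ.<⇒≢ (ℕₚ.m<n⇒m<1+n i<k))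

  sumFin-toℕ : ∀ n (f : Row) → sumFin R n (f ∘ Fin.toℕ) ≈ ∑ n f
  sumFin-toℕ zero    f = refl
  sumFin-toℕ (suc n) f = trans (+-congˡ (sumFin-toℕ n (f ∘ suc))) (sym (∑-front n f))

  δ : ℕ → ℕ → Carrier
  δ zero    zero    = 1#
  δ zero    (suc k) = 0#
  δ (suc j) zero    = 0#
  δ (suc j) (suc k) = δ j k

  δ-diag : ∀ j → δ j j ≡ 1#
  δ-diag zero    = ≡.refl
  δ-diag (suc j) = δ-diag j

  δ-off-diag : ∀ {j k} → j ≢ k → δ j k ≡ 0#
  δ-off-diag {zero}  {zero}  j≢k = contradiction ≡.refl j≢k
  δ-off-diag {zero}  {suc k} j≢k = ≡.refl
  δ-off-diag {suc j} {zero}  j≢k = ≡.refl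
  δ-off-diag {suc j} {suc k} j≢k = δ-off-diag (j≢k ∘ ≡.cong suc)

  ∑-δ : ∀ m j (f : Row) → j < m → ∑ m (λ k → f k * δ j k) ≈ f j
  ∑-δ m j f j<m = trans (∑-single m j j<m off-j) (trans (*-congˡ (reflexive (δ-diag j))) (*-identityʳ _))
    where
    off-j : ∀ k → k < m → k ≢ j → f k * δ j k ≈ 0#
    off-j k _ k≢j = trans (*-congˡ (reflexive (δ-off-diag (k≢j ∘ ≡.sym)))) (zeroʳ _)

  -- Determinants of ℕ-indexed matrices

  -- Indexing by ℕ keeps all row arithmetic in ℕ; detℕ n reads only the entries below n,
  -- which is why the hypotheses of the lemmas below are bounded.
  Matrix : Set ℓ₁
  Matrix = ℕ → Row

  punchInℕ : ℕ → ℕ → ℕ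
  punchInℕ zero    r       = suc r
  punchInℕ (suc i) zero    = zero
  punchInℕ (suc i) (suc r) = suc (punchInℕ i r)

  punchOutℕ : ℕ → ℕ → ℕ
  punchOutℕ zero    zero    = zero
  punchOutℕ zero    (suc k) = k
  punchOutℕ (suc i) zero    = zero
  punchOutℕ (suc i) (suc k) = suc (punchOutℕ i k)

  toℕ-punchIn : ∀ {n} (i : Fin (suc n)) (r : Fin n) →
                Fin.toℕ (Fin.punchIn i r) ≡ punchInℕ (Fin.toℕ i) (Fin.toℕ r)
  toℕ-punchIn Fin.zero    r           = ≡.refl
  toℕ-punchIn (Fin.suc i) Fin.zero    = ≡.refl
  toℕ-punchIn (Fin.suc i) (Fin.suc r) = ≡.cong suc (toℕ-punchIn i r)

  punchInℕ-punchOutℕ : ∀ {i k} → i ≢ k → punchInℕ i (punchOutℕ i k) ≡ k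
  punchInℕ-punchOutℕ {zero}  {zero}  i≢k = contradiction ≡.refl i≢k
  punchInℕ-punchOutℕ {zero}  {suc k} i≢k = ≡.refl
  punchInℕ-punchOutℕ {suc i} {zero}  i≢k = ≡.refl
  punchInℕ-punchOutℕ {suc i} {suc k} i≢k = ≡.cong suc (punchInℕ-punchOutℕ (i≢k ∘ ≡.cong suc))

  punchInℕ-injective : ∀ i r s → punchInℕ i r ≡ punchInℕ i s → r ≡ s
  punchInℕ-injective zero    r       s       eq = ℕₚ.suc-injective eq
  punchInℕ-injective (suc i) zero    zero    eq = ≡.refl
  punchInℕ-injective (suc i) (suc r) (suc s) eq = ≡.cong suc (punchInℕ-injective i r s (ℕₚ.suc-injective eq))

  punchInℕᵢ≢i : ∀ i r → punchInℕ i r ≢ i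
  punchInℕᵢ≢i (suc i) (suc r) eq = punchInℕᵢ≢i i r (ℕₚ.suc-injective eq)

  punchInℕ-< : ∀ {i r} → r < i → punchInℕ i r ≡ r
  punchInℕ-< {suc i} {zero}  _         = ≡.refl
  punchInℕ-< {suc i} {suc r} (s≤s r<i) = ≡.cong suc (punchInℕ-< r<i)

  punchInℕ-≥ : ∀ {i r} → i ≤ r → punchInℕ i r ≡ suc r
  punchInℕ-≥ {zero}  {r}     _         = ≡.refl
  punchInℕ-≥ {suc i} {suc r} (s≤s i≤r) = ≡.cong suc (punchInℕ-≥ i≤r)

  punchInℕ-bounded : ∀ {n i r} → i < suc n → r < n → punchInℕ i r < suc n
  punchInℕ-bounded {n}     {zero}  {r}     _         r<n       = s≤s r<n
  punchInℕ-bounded {n}     {suc i} {zero}  _         _         = z<s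
  punchInℕ-bounded {suc n} {suc i} {suc r} (s≤s i<n) (s≤s r<n) = s≤s (punchInℕ-bounded i<n r<n)

  punchOutℕ-bounded : ∀ {n i k} → i < suc n → k < suc n → i ≢ k → punchOutℕ i k < n
  punchOutℕ-bounded {n}     {zero}  {zero}  _         _         i≢k = contradiction ≡.refl i≢k
  punchOutℕ-bounded {n}     {zero}  {suc k} _         (s≤s k<n) _   = k<n
  punchOutℕ-bounded {suc n} {suc i} {zero}  _         _         _   = z<s
  punchOutℕ-bounded {suc n} {suc i} {suc k} (s≤s i<n) (s≤s k<n) i≢k =
    s≤s (punchOutℕ-bounded i<n k<n (i≢k ∘ ≡.cong suc))
  punchOutℕ-bounded {zero}  {suc i} {k}     (s≤s ())  _         _

  sign : ℕ → Carrier
  sign i = pow R (- 1#) i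

  minor : Matrix → ℕ → Matrix
  minor N i r s = N (punchInℕ i r) (suc s)

  detℕ : ℕ → Matrix → Carrier
  laplaceTerm : ℕ → Matrix → ℕ → Carrier

  detℕ zero    N = 1#
  detℕ (suc n) N = ∑ (suc n) (laplaceTerm n N)

  laplaceTerm n N i = sign i * (N i 0 * detℕ n (minor N i))

  sumFin-cong : ∀ n {f g : Fin n → Carrier} → (∀ i → f i ≈ g i) → sumFin R n f ≈ sumFin R n g
  sumFin-cong zero    f≈g = refl
  sumFin-cong (suc n) f≈g = +-cong (f≈g Fin.zero) (sumFin-cong n (f≈g ∘ Fin.suc))

  det≈detℕ : ∀ n {M : Fin n → Fin n → Carrier} {N : Matrix} →
             (∀ i j → M i j ≈ N (Fin.toℕ i) (Fin.toℕ j)) → det R n M ≈ detℕ n N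
  det≈detℕ zero    M≈N = refl
  det≈detℕ (suc n) {M} {N} M≈N = trans (sumFin-cong (suc n) term) (sumFin-toℕ (suc n) (laplaceTerm n N))
    where
    term : ∀ i → sign (Fin.toℕ i) * (M i Fin.zero * det R n (λ r s → M (Fin.punchIn i r) (Fin.suc s)))
               ≈ laplaceTerm n N (Fin.toℕ i)
    term i = *-congˡ (*-cong (M≈N i Fin.zero) (det≈detℕ n (λ r s →
      trans (M≈N (Fin.punchIn i r) (Fin.suc s)) (reflexive (≡.cong (λ k → N k _) (toℕ-punchIn i r))))))

  detℕ-cong : ∀ n {M N : Matrix} → (∀ i j → i < n → j < n → M i j ≈ N i j) → detℕ n M ≈ detℕ n N
  detℕ-cong zero    M≈N = refl
  detℕ-cong (suc n) M≈N = ∑-cong (suc n) (λ i i<n → *-congˡ (*-cong (M≈N i 0 i<n z<s)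
    (detℕ-cong n (λ r s r<n s<n → M≈N _ _ (punchInℕ-bounded i<n r<n) (s≤s s<n)))))

  detℕ-linear : ∀ n k a b {A B C : Matrix} → k < n →
    (∀ i j → i < n → j < n → i ≢ k → A i j ≈ C i j) →
    (∀ i j → i < n → j < n → i ≢ k → B i j ≈ C i j) →
    (∀ j → j < n → C k j ≈ a * A k j + b * B k j) →
    detℕ n C ≈ a * detℕ n A + b * detℕ n B
  detℕ-linear (suc n) k a b {A} {B} {C} k<n A≈C B≈C Cₖ≈ = ∑-linear (suc n) a b term
    where
    term : ∀ i → i < suc n → laplaceTerm n C i ≈ a * laplaceTerm n A i + b * laplaceTerm n B i
    term i i<n with i ≟ k
    ... | yes ≡.refl = begin
      sign i * (C i 0 * d)                                      ≈⟨ *-congˡ (*-congʳ (Cₖ≈ 0 z<s)) ⟩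
      sign i * ((a * A i 0 + b * B i 0) * d)                    ≈⟨ *-congˡ (*-linearʳ a b _ _ d) ⟩
      sign i * (a * (A i 0 * d) + b * (B i 0 * d))              ≈⟨ *-linear (sign i) a b _ _ ⟩
      a * (sign i * (A i 0 * d)) + b * (sign i * (B i 0 * d))   ≈⟨ +-cong (*-congˡ (*-congˡ (*-congˡ (same-minor A≈C))))
                                                                          (*-congˡ (*-congˡ (*-congˡ (same-minor B≈C)))) ⟩
      a * laplaceTerm n A i + b * laplaceTerm n B i             ∎
      where
      d = detℕ n (minor C i)
      same-minor : ∀ {M} → (∀ i j → i < suc n → j < suc n → i ≢ k → M i j ≈ C i j) → d ≈ detℕ n (minor M i)
      same-minor M≈C = sym (detℕ-cong n (λ r s r<n s<n →
        M≈C _ _ (punchInℕ-bounded i<n r<n) (s≤s s<n) (punchInℕᵢ≢i i r)))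
    ... | no i≢k = begin
      sign i * (C i 0 * detℕ n (minor C i))
        ≈⟨ *-congˡ (*-cong (sym (A≈C i 0 i<n z<s i≢k)) minor-linear) ⟩
      sign i * (A i 0 * (a * detℕ n (minor A i) + b * detℕ n (minor B i)))
        ≈⟨ *-congˡ (*-linear _ a b _ _) ⟩
      sign i * (a * (A i 0 * detℕ n (minor A i)) + b * (A i 0 * detℕ n (minor B i)))
        ≈⟨ *-linear (sign i) a b _ _ ⟩
      a * laplaceTerm n A i + b * (sign i * (A i 0 * detℕ n (minor B i)))
        ≈⟨ +-congˡ (*-congˡ (*-congˡ (*-congʳ Aᵢ₀≈Bᵢ₀))) ⟩
      a * laplaceTerm n A i + b * laplaceTerm n B i ∎
      where
      Aᵢ₀≈Bᵢ₀ : A i 0 ≈ B i 0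
      Aᵢ₀≈Bᵢ₀ = trans (A≈C i 0 i<n z<s i≢k) (sym (B≈C i 0 i<n z<s i≢k))
      k′ = punchOutℕ i k
      off-k : ∀ {r} → r ≢ k′ → punchInℕ i r ≢ k
      off-k r≢k′ eq = r≢k′ (punchInℕ-injective i _ k′ (≡.trans eq (≡.sym (punchInℕ-punchOutℕ i≢k))))
      minor-linear : detℕ n (minor C i) ≈ a * detℕ n (minor A i) + b * detℕ n (minor B i)
      minor-linear = detℕ-linear n k′ a b (punchOutℕ-bounded i<n k<n i≢k)
        (λ r s r<n s<n r≢k′ → A≈C _ _ (punchInℕ-bounded i<n r<n) (s≤s s<n) (off-k r≢k′))
        (λ r s r<n s<n r≢k′ → B≈C _ _ (punchInℕ-bounded i<n r<n) (s≤s s<n) (off-k r≢k′))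
        (λ s s<n → ≡.subst (λ z → C z (suc s) ≈ a * A z (suc s) + b * B z (suc s))
                           (≡.sym (punchInℕ-punchOutℕ i≢k)) (Cₖ≈ (suc s) (s≤s s<n)))

  laplaceTerm-zero : ∀ n N i → detℕ n (minor N i) ≈ 0# → laplaceTerm n N i ≈ 0#
  laplaceTerm-zero n N i minor≈0 = trans (*-congˡ (trans (*-congˡ minor≈0) (zeroʳ _))) (zeroʳ _)

  detℕ-zero-row : ∀ n k {N : Matrix} → k < n → (∀ j → j < n → N k j ≈ 0#) → detℕ n N ≈ 0#
  detℕ-zero-row n k {N} k<n Nₖ≈0 = begin
    detℕ n N                        ≈⟨ detℕ-linear n k 0# 0# k<n same same Nₖ≈0*Nₖ+0*Nₖ ⟩
    0# * detℕ n N + 0# * detℕ n N   ≈⟨ +-cong (zeroˡ _) (zeroˡ _) ⟩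
    0# + 0#                         ≈⟨ +-identityˡ 0# ⟩
    0#                              ∎
    where
    same : ∀ i j → i < n → j < n → i ≢ k → N i j ≈ N i j
    same _ _ _ _ _ = refl
    Nₖ≈0*Nₖ+0*Nₖ : ∀ j → j < n → N k j ≈ 0# * N k j + 0# * N k j
    Nₖ≈0*Nₖ+0*Nₖ j j<n = trans (Nₖ≈0 j j<n) (sym (trans (+-cong (zeroˡ _) (zeroˡ _)) (+-identityˡ 0#)))

  minor-adjacent : ∀ n k {N : Matrix} → (∀ j → j < n → N k (suc j) ≈ N (suc k) (suc j)) →
                   ∀ r s → s < n → minor N k r s ≈ minor N (suc k) r s
  minor-adjacent n k {N} Nₖ≈Nₖ₊₁ r s s<n with ℕₚ.<-cmp r k
  ... | tri< r<k _ _ = reflexive (≡.cong (λ i → N i (suc s))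
          (≡.trans (punchInℕ-< r<k) (≡.sym (punchInℕ-< (ℕₚ.m<n⇒m<1+n r<k)))))
  ... | tri≈ _ ≡.refl _ = ≡.subst₂ (λ i i′ → N i (suc s) ≈ N i′ (suc s))
          (≡.sym (punchInℕ-≥ ℕₚ.≤-refl)) (≡.sym (punchInℕ-< ℕₚ.≤-refl)) (sym (Nₖ≈Nₖ₊₁ s s<n))
  ... | tri> _ _ k<r = reflexive (≡.cong (λ i → N i (suc s))
          (≡.trans (punchInℕ-≥ (ℕₚ.<⇒≤ k<r)) (≡.sym (punchInℕ-≥ k<r))))

  -- Every minor other than those at k and k+1 still has two equal adjacent rows; those two
  -- minors coincide and enter the expansion with opposite signs.
  detℕ-adjacent-equal-rows : ∀ n k {N : Matrix} → suc k < n →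
    (∀ j → j < n → N k j ≈ N (suc k) j) → detℕ n N ≈ 0#
  detℕ-adjacent-equal-rows (suc n) k {N} 1+k<1+n Nₖ≈Nₖ₊₁ =
    ∑-cancelling-pair (suc n) k 1+k<1+n other-term pair-cancels
    where
    other-term : ∀ i → i < suc n → i ≢ k → i ≢ suc k → laplaceTerm n N i ≈ 0#
    other-term i i<1+n i≢k i≢1+k with ℕₚ.<-cmp i k
    ... | tri≈ _ i≡k _ = contradiction i≡k i≢k
    ... | tri< i<k _ _ = laplaceTerm-zero n N i (minor-below k i<k 1+k<1+n Nₖ≈Nₖ₊₁)
      where
      minor-below : ∀ k → i < k → suc k < suc n → (∀ j → j < suc n → N k j ≈ N (suc k) j) →
                    detℕ n (minor N i) ≈ 0#
      minor-below (suc k₀) (s≤s i≤k₀) (s≤s 1+k₀<n) Nₖ≈Nₖ₊₁′ =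
        detℕ-adjacent-equal-rows n k₀ 1+k₀<n (λ j j<n →
          ≡.subst₂ (λ r r′ → N r (suc j) ≈ N r′ (suc j))
            (≡.sym (punchInℕ-≥ i≤k₀)) (≡.sym (punchInℕ-≥ (ℕₚ.m≤n⇒m≤1+n i≤k₀)))
            (Nₖ≈Nₖ₊₁′ (suc j) (s≤s j<n)))
    ... | tri> _ _ k<i =
      laplaceTerm-zero n N i (detℕ-adjacent-equal-rows n k 1+k<n (λ j j<n →
        ≡.subst₂ (λ r r′ → N r (suc j) ≈ N r′ (suc j))
          (≡.sym (punchInℕ-< k<i)) (≡.sym (punchInℕ-< 1+k<i)) (Nₖ≈Nₖ₊₁ (suc j) (s≤s j<n))))
      where
      1+k<i : suc k < i
      1+k<i = ℕₚ.≤∧≢⇒< k<i (i≢1+k ∘ ≡.sym)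
      1+k<n : suc k < n
      1+k<n = ℕₚ.<-≤-trans 1+k<i (ℕₚ.≤-pred i<1+n)
    pair-cancels : laplaceTerm n N k + laplaceTerm n N (suc k) ≈ 0#
    pair-cancels = begin
      sign k * x + sign (suc k) * (N (suc k) 0 * detℕ n (minor N (suc k)))
        ≈⟨ +-congˡ (*-cong (-1*x≈-x (sign k)) (*-cong (sym (Nₖ≈Nₖ₊₁ 0 z<s))
             (detℕ-cong n (λ r s _ s<n → sym (minor-adjacent n k {N} (λ j j<n → Nₖ≈Nₖ₊₁ (suc j) (s≤s j<n)) r s s<n))))) ⟩
      sign k * x + - sign k * x ≈⟨ +-congˡ (sym (-‿distribˡ-* _ _)) ⟩
      sign k * x - sign k * x   ≈⟨ -‿inverseʳ _ ⟩
      0#                        ∎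
      where x = N k 0 * detℕ n (minor N k)

  setRow : Matrix → ℕ → Row → Matrix
  setRow N zero    x zero    = x
  setRow N zero    x (suc i) = N (suc i)
  setRow N (suc k) x zero    = N zero
  setRow N (suc k) x (suc i) = setRow (N ∘ suc) k x i

  setRow-≡ : ∀ N k x → setRow N k x k ≡ x
  setRow-≡ N zero    x = ≡.refl
  setRow-≡ N (suc k) x = setRow-≡ (N ∘ suc) k x

  setRow-≢ : ∀ N k x {i} → i ≢ k → setRow N k x i ≡ N i
  setRow-≢ N zero    x {zero}  i≢k = contradiction ≡.refl i≢k
  setRow-≢ N zero    x {suc i} i≢k = ≡.refl
  setRow-≢ N (suc k) x {zero}  i≢k = ≡.refl
  setRow-≢ N (suc k) x {suc i} i≢k = setRow-≢ (N ∘ suc) k x (i≢k ∘ ≡.cong suc)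

  setRows : Matrix → ℕ → Row → Row → Matrix
  setRows N k u v = setRow (setRow N k u) (suc k) v

  setRows-k : ∀ N k u v → setRows N k u v k ≡ u
  setRows-k N k u v = ≡.trans (setRow-≢ (setRow N k u) (suc k) v (λ ())) (setRow-≡ N k u)

  setRows-1+k : ∀ N k u v → setRows N k u v (suc k) ≡ v
  setRows-1+k N k u v = setRow-≡ (setRow N k u) (suc k) v

  setRows-≢ : ∀ N k u v {i} → i ≢ k → i ≢ suc k → setRows N k u v i ≡ N i
  setRows-≢ N k u v i≢k i≢1+k = ≡.trans (setRow-≢ (setRow N k u) (suc k) v i≢1+k) (setRow-≢ N k u i≢k)

  setRows-self : ∀ N k i → setRows N k (N k) (N (suc k)) i ≡ N i
  setRows-self N k i with i ≟ k | i ≟ suc k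
  ... | yes ≡.refl | _          = setRows-k N i (N i) (N (suc i))
  ... | no _       | yes ≡.refl = setRows-1+k N k (N k) (N (suc k))
  ... | no i≢k     | no i≢1+k   = setRows-≢ N k (N k) (N (suc k)) i≢k i≢1+k

  entry : ∀ {x y : Row} j → x ≡ y → x j ≈ y j
  entry j x≡y = reflexive (≡.cong (λ x → x j) x≡y)

  detℕ-additive : ∀ n k {A B C : Matrix} → k < n →
    (∀ i → i ≢ k → A i ≡ C i) → (∀ i → i ≢ k → B i ≡ C i) →
    (∀ j → C k j ≈ A k j + B k j) → detℕ n C ≈ detℕ n A + detℕ n B
  detℕ-additive n k {A} {B} {C} k<n A≡C B≡C Cₖ≈ = begin
    detℕ n C                           ≈⟨ detℕ-linear n k 1# 1# k<n
                                            (λ i j _ _ i≢k → entry j (A≡C i i≢k)) (λ i j _ _ i≢k → entry j (B≡C i i≢k))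
                                            (λ j _ → trans (Cₖ≈ j) (sym (+-cong (*-identityˡ _) (*-identityˡ _)))) ⟩
    1# * detℕ n A + 1# * detℕ n B      ≈⟨ +-cong (*-identityˡ _) (*-identityˡ _) ⟩
    detℕ n A + detℕ n B                ∎

  -- B u v, the determinant with rows k, k+1 replaced by u, v, is biadditive and vanishes on
  -- the diagonal, so B x y + B y x = B (x+y) (x+y) − B x x − B y y = 0.
  detℕ-swap-adjacent : ∀ n k (N : Matrix) → suc k < n →
    detℕ n (setRows N k (N (suc k)) (N k)) ≈ - detℕ n N
  detℕ-swap-adjacent n k N 1+k<n = +-inverseˡ-unique _ _ (begin
    B y x + detℕ n N                          ≈⟨ +-comm _ _ ⟩
    detℕ n N + B y x                          ≈⟨ +-cong (trans (+-identityˡ _) B-self) (+-identityʳ _) ⟨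
    (0# + B x y) + (B y x + 0#)               ≈⟨ +-cong (+-congʳ (B-diag x)) (+-congˡ (B-diag y)) ⟨
    (B x x + B x y) + (B y x + B y y)         ≈⟨ +-cong (B-additiveʳ x x y) (B-additiveʳ y x y) ⟨
    B x x+y + B y x+y                         ≈⟨ B-additiveˡ x y x+y ⟨
    B x+y x+y                                 ≈⟨ B-diag x+y ⟩
    0#                                        ∎)
    where
    x y x+y : Row
    x = N k
    y = N (suc k)
    x+y j = x j + y j
    B : Row → Row → Carrier
    B u v = detℕ n (setRows N k u v)
    off-k : ∀ u u′ v i → i ≢ k → setRows N k u v i ≡ setRows N k u′ v i
    off-k u u′ v i i≢k with i ≟ suc k
    ... | yes ≡.refl = ≡.trans (setRows-1+k N k u v) (≡.sym (setRows-1+k N k u′ v))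
    ... | no i≢1+k   = ≡.trans (setRows-≢ N k u v i≢k i≢1+k) (≡.sym (setRows-≢ N k u′ v i≢k i≢1+k))
    off-1+k : ∀ u v v′ i → i ≢ suc k → setRows N k u v i ≡ setRows N k u v′ i
    off-1+k u v v′ i i≢1+k =
      ≡.trans (setRow-≢ (setRow N k u) (suc k) v i≢1+k) (≡.sym (setRow-≢ (setRow N k u) (suc k) v′ i≢1+k))
    B-additiveˡ : ∀ u₁ u₂ v → B (λ j → u₁ j + u₂ j) v ≈ B u₁ v + B u₂ v
    B-additiveˡ u₁ u₂ v = detℕ-additive n k (ℕₚ.<-trans (ℕₚ.n<1+n k) 1+k<n)
      (λ i → off-k u₁ _ v i) (λ i → off-k u₂ _ v i)
      (λ j → trans (entry j (setRows-k N k _ v))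
                   (sym (+-cong (entry j (setRows-k N k u₁ v)) (entry j (setRows-k N k u₂ v)))))
    B-additiveʳ : ∀ u v₁ v₂ → B u (λ j → v₁ j + v₂ j) ≈ B u v₁ + B u v₂
    B-additiveʳ u v₁ v₂ = detℕ-additive n (suc k) 1+k<n
      (λ i → off-1+k u v₁ _ i) (λ i → off-1+k u v₂ _ i)
      (λ j → trans (entry j (setRows-1+k N k u _))
                   (sym (+-cong (entry j (setRows-1+k N k u v₁)) (entry j (setRows-1+k N k u v₂)))))
    B-diag : ∀ u → B u u ≈ 0#
    B-diag u = detℕ-adjacent-equal-rows n k 1+k<n
      (λ j _ → trans (entry j (setRows-k N k u u)) (sym (entry j (setRows-1+k N k u u))))
    B-self : B x y ≈ detℕ n N
    B-self = detℕ-cong n (λ i j _ _ → entry j (setRows-self N k i))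

  -- The copy at row b+1 is swapped up until it sits next to row a.
  detℕ-equal-rows-< : ∀ n a b {N : Matrix} → a < b → b < n →
    (∀ j → j < n → N a j ≈ N b j) → detℕ n N ≈ 0#
  detℕ-equal-rows-< n a (suc b) {N} a<1+b 1+b<n Nₐ≈N₁₊b with ℕₚ.m<1+n⇒m<n∨m≡n a<1+b
  ... | inj₂ ≡.refl = detℕ-adjacent-equal-rows n a 1+b<n Nₐ≈N₁₊b
  ... | inj₁ a<b    =
    -‿injective (trans (sym (detℕ-swap-adjacent n b N 1+b<n)) (trans swapped≈0 (sym -0#≈0#)))
    where
    swapped : Matrix
    swapped = setRows N b (N (suc b)) (N b)
    swapped≈0 : detℕ n swapped ≈ 0#
    swapped≈0 = detℕ-equal-rows-< n a b a<b (ℕₚ.<-trans (ℕₚ.n<1+n b) 1+b<n) (λ j j<n →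
      trans (entry j (setRows-≢ N b (N (suc b)) (N b) (ℕₚ.<⇒≢ a<b) (ℕₚ.<⇒≢ a<1+b)))
            (trans (Nₐ≈N₁₊b j j<n) (sym (entry j (setRows-k N b (N (suc b)) (N b))))))

  detℕ-equal-rows : ∀ n a b {N : Matrix} → a ≢ b → a < n → b < n →
    (∀ j → j < n → N a j ≈ N b j) → detℕ n N ≈ 0#
  detℕ-equal-rows n a b a≢b a<n b<n Nₐ≈N_b with ℕₚ.<-cmp a b
  ... | tri< a<b _ _ = detℕ-equal-rows-< n a b a<b b<n Nₐ≈N_b
  ... | tri≈ _ a≡b _ = contradiction a≡b a≢b
  ... | tri> _ _ b<a = detℕ-equal-rows-< n b a b<a a<n (λ j j<n → sym (Nₐ≈N_b j j<n))

  detℕ-add-row-multiple : ∀ n k l c {A B : Matrix} → k ≢ l → k < n → l < n →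
    (∀ i j → i < n → j < n → i ≢ k → A i j ≈ B i j) →
    (∀ j → j < n → B k j ≈ A k j + c * A l j) → detℕ n B ≈ detℕ n A
  detℕ-add-row-multiple n k l c {A} {B} k≢l k<n l<n A≈B Bₖ≈ = begin
    detℕ n B                                      ≈⟨ detℕ-linear n k 1# c k<n A≈B A≈copy Bₖ≈A+c*copy ⟩
    1# * detℕ n A + c * detℕ n (setRow A k (A l)) ≈⟨ +-cong (*-identityˡ _) (*-congˡ copy≈0) ⟩
    detℕ n A + c * 0#                             ≈⟨ +-congˡ (zeroʳ c) ⟩
    detℕ n A + 0#                                 ≈⟨ +-identityʳ _ ⟩
    detℕ n A                                      ∎
    where
    A≈copy : ∀ i j → i < n → j < n → i ≢ k → setRow A k (A l) i j ≈ B i j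
    A≈copy i j i<n j<n i≢k = trans (entry j (setRow-≢ A k (A l) i≢k)) (A≈B i j i<n j<n i≢k)
    Bₖ≈A+c*copy : ∀ j → j < n → B k j ≈ 1# * A k j + c * setRow A k (A l) k j
    Bₖ≈A+c*copy j j<n = trans (Bₖ≈ j j<n) (+-cong (sym (*-identityˡ _)) (*-congˡ (sym (entry j (setRow-≡ A k (A l))))))
    copy≈0 : detℕ n (setRow A k (A l)) ≈ 0#
    copy≈0 = detℕ-equal-rows n k l k≢l k<n l<n (λ j _ →
      trans (entry j (setRow-≡ A k (A l))) (sym (entry j (setRow-≢ A k (A l) (k≢l ∘ ≡.sym)))))

  detℕ-first-row-combination : ∀ m n {N : Matrix} (c : Row) → m < n →
    (∀ j → j < n → N 0 j ≈ ∑ m (λ k → c k * N (suc k) j)) → detℕ n N ≈ 0#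
  detℕ-first-row-combination zero    n c 0<n N₀≈0 = detℕ-zero-row n 0 0<n N₀≈0
  detℕ-first-row-combination (suc m) n {N} c 1+m<n N₀≈ = trans
    (detℕ-add-row-multiple n 0 (suc m) (c m) (λ ()) (ℕₚ.<-trans z<s 1+m<n) 1+m<n
      (λ i j _ _ i≢0 → entry j (setRow-≢ N 0 shorter i≢0)) N₀≈)
    (detℕ-first-row-combination m n c (ℕₚ.<-trans (ℕₚ.n<1+n m) 1+m<n) (λ _ _ → refl))
    where
    shorter : Row
    shorter j = ∑ m (λ k → c k * N (suc k) j)

  overlay : ℕ → Matrix → Matrix → Matrix
  overlay m A B i with i ≤? m
  ... | yes _ = A i
  ... | no  _ = B i

  overlay-≤ : ∀ A B {m i} → i ≤ m → overlay m A B i ≡ A i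
  overlay-≤ A B {m} {i} i≤m with i ≤? m
  ... | yes _   = ≡.refl
  ... | no  i≰m = contradiction i≤m i≰m

  overlay-> : ∀ A B {m i} → m < i → overlay m A B i ≡ B i
  overlay-> A B {m} {i} m<i with i ≤? m
  ... | yes i≤m = contradiction i≤m (ℕₚ.<⇒≱ m<i)
  ... | no  _   = ≡.refl

  overlay-suc : ∀ A B {m i} → i ≢ suc m → overlay m A B i ≡ overlay (suc m) A B i
  overlay-suc A B {m} {i} i≢1+m with ℕₚ.<-cmp i (suc m)
  ... | tri< i<1+m _ _ = ≡.trans (overlay-≤ A B (ℕₚ.≤-pred i<1+m)) (≡.sym (overlay-≤ A B (ℕₚ.<⇒≤ i<1+m)))
  ... | tri≈ _ i≡1+m _ = contradiction i≡1+m i≢1+m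
  ... | tri> _ _ 1+m<i = ≡.trans (overlay-> A B (ℕₚ.<-trans (ℕₚ.n<1+n m) 1+m<i)) (≡.sym (overlay-> A B 1+m<i))

  detℕ-overlay-first : ∀ p {A B : Matrix} → (∀ j → j < suc p → A 0 j ≈ B 0 j) →
                       detℕ (suc p) (overlay 0 A B) ≈ detℕ (suc p) B
  detℕ-overlay-first p {A} {B} A₀≈B₀ = detℕ-cong (suc p) first
    where
    first : ∀ i j → i < suc p → j < suc p → overlay 0 A B i j ≈ B i j
    first zero    j _ j<n = trans (entry j (overlay-≤ A B {0} z≤n)) (A₀≈B₀ j j<n)
    first (suc i) j _ _   = entry j (overlay-> A B z<s)

  detℕ-overlay-all : ∀ p {A B : Matrix} → detℕ (suc p) (overlay p A B) ≈ detℕ (suc p) A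
  detℕ-overlay-all p {A} {B} = detℕ-cong (suc p) (λ i j i<n _ → entry j (overlay-≤ A B (ℕₚ.≤-pred i<n)))

  telescope : ∀ p (f : ℕ → Carrier) → (∀ m → m < p → f m ≈ f (suc m)) → f 0 ≈ f p
  telescope zero    f step = refl
  telescope (suc p) f step = trans (telescope p f (λ m m<p → step m (ℕₚ.m<n⇒m<1+n m<p))) (step p ℕₚ.≤-refl)

  -- Rows are replaced from the bottom up, so row m is still original when row m+1 is changed;
  -- overlay m M N is the intermediate matrix whose rows 0, …, m are original.
  detℕ-successive-differences : ∀ p {M N : Matrix} →
    (∀ j → j < suc p → N 0 j ≈ M 0 j) →
    (∀ i j → i < p → j < suc p → N (suc i) j ≈ M (suc i) j - M i j) →
    detℕ (suc p) N ≈ detℕ (suc p) M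
  detℕ-successive-differences p {M} {N} N₀≈M₀ Nᵢ₊₁≈ = begin
    detℕ (suc p) N                ≈⟨ detℕ-overlay-first p (λ j j<n → sym (N₀≈M₀ j j<n)) ⟨
    detℕ (suc p) (overlay 0 M N)  ≈⟨ telescope p (λ m → detℕ (suc p) (overlay m M N)) step ⟩
    detℕ (suc p) (overlay p M N)  ≈⟨ detℕ-overlay-all p ⟩
    detℕ (suc p) M                ∎
    where
    step : ∀ m → m < p → detℕ (suc p) (overlay m M N) ≈ detℕ (suc p) (overlay (suc m) M N)
    step m m<p = detℕ-add-row-multiple (suc p) (suc m) m (- 1#) (λ ()) (s≤s m<p) (ℕₚ.m<n⇒m<1+n m<p)
      (λ i j _ _ i≢1+m → entry j (≡.sym (overlay-suc M N i≢1+m))) row-1+m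
      where
      row-1+m : ∀ j → j < suc p → overlay m M N (suc m) j ≈ overlay (suc m) M N (suc m) j + - 1# * overlay (suc m) M N m j
      row-1+m j j<n = begin
        overlay m M N (suc m) j        ≡⟨ ≡.cong (λ x → x j) (overlay-> M N ℕₚ.≤-refl) ⟩
        N (suc m) j                    ≈⟨ Nᵢ₊₁≈ m j m<p j<n ⟩
        M (suc m) j - M m j            ≈⟨ +-congˡ (-1*x≈-x _) ⟨
        M (suc m) j + - 1# * M m j     ≡⟨ ≡.cong₂ (λ x y → x j + - 1# * y j)
                                            (overlay-≤ M N ℕₚ.≤-refl) (overlay-≤ M N (ℕₚ.n≤1+n m)) ⟨
        overlay (suc m) M N (suc m) j + - 1# * overlay (suc m) M N m j ∎

  detℕ-add-multiples-of-first-row : ∀ p {M N : Matrix} (c : Row) →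
    (∀ j → j < suc p → N 0 j ≈ M 0 j) →
    (∀ i j → i < p → j < suc p → N (suc i) j ≈ M (suc i) j + c i * M 0 j) →
    detℕ (suc p) N ≈ detℕ (suc p) M
  detℕ-add-multiples-of-first-row p {M} {N} c N₀≈M₀ Nᵢ₊₁≈ = begin
    detℕ (suc p) N                ≈⟨ detℕ-overlay-all p ⟨
    detℕ (suc p) (overlay p N M)  ≈⟨ telescope p (λ m → detℕ (suc p) (overlay m N M)) step ⟨
    detℕ (suc p) (overlay 0 N M)  ≈⟨ detℕ-overlay-first p N₀≈M₀ ⟩
    detℕ (suc p) M                ∎
    where
    step : ∀ m → m < p → detℕ (suc p) (overlay m N M) ≈ detℕ (suc p) (overlay (suc m) N M)
    step m m<p = sym (detℕ-add-row-multiple (suc p) (suc m) 0 (c m) (λ ()) (s≤s m<p) z<s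
      (λ i j _ _ i≢1+m → entry j (overlay-suc N M i≢1+m)) row-1+m)
      where
      row-1+m : ∀ j → j < suc p → overlay (suc m) N M (suc m) j ≈ overlay m N M (suc m) j + c m * overlay m N M 0 j
      row-1+m j j<n = begin
        overlay (suc m) N M (suc m) j            ≡⟨ ≡.cong (λ x → x j) (overlay-≤ N M ℕₚ.≤-refl) ⟩
        N (suc m) j                              ≈⟨ Nᵢ₊₁≈ m j m<p j<n ⟩
        M (suc m) j + c m * M 0 j                ≈⟨ +-cong (entry j (overlay-> N M ℕₚ.≤-refl)) (*-congˡ (N₀≈M₀ j j<n)) ⟨
        overlay m N M (suc m) j + c m * N 0 j    ≡⟨ ≡.cong (λ x → overlay m N M (suc m) j + c m * x j) (overlay-≤ N M {m} z≤n) ⟨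
        overlay m N M (suc m) j + c m * overlay m N M 0 j ∎

  ones : Row
  ones _ = 1#

  onesAboveScaledIdentity : Carrier → Matrix
  onesAboveScaledIdentity a zero    j = 1#
  onesAboveScaledIdentity a (suc i) j = a * δ j i

  detℕ-onesAboveScaledIdentity : ∀ p a → detℕ (suc p) (onesAboveScaledIdentity a) ≈ pow R (- a) p
  detℕ-onesAboveScaledIdentity zero    a = trans (+-identityˡ _) (trans (*-identityˡ _) (*-identityˡ _))
  detℕ-onesAboveScaledIdentity (suc p) a = begin
    detℕ (suc (suc p)) P                    ≈⟨ ∑-single (suc (suc p)) 1 (s≤s z<s) other-term ⟩
    - 1# * 1# * (a * 1# * detℕ (suc p) (minor P 1))
                                            ≈⟨ *-cong (*-identityʳ _) (*-cong (*-identityʳ a) (detℕ-cong (suc p) minor₁≈P)) ⟩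
    - 1# * (a * detℕ (suc p) P)             ≈⟨ *-assoc _ _ _ ⟨
    - 1# * a * detℕ (suc p) P               ≈⟨ *-cong (-1*x≈-x a) (detℕ-onesAboveScaledIdentity p a) ⟩
    - a * pow R (- a) p                     ∎
    where
    P = onesAboveScaledIdentity a
    minor₁≈P : ∀ r s → r < suc p → s < suc p → minor P 1 r s ≈ P r s
    minor₁≈P zero    s _ _ = refl
    minor₁≈P (suc r) s _ _ = refl
    other-term : ∀ i → i < suc (suc p) → i ≢ 1 → laplaceTerm (suc p) P i ≈ 0#
    other-term zero          _ _   =
      laplaceTerm-zero (suc p) P 0 (detℕ-zero-row (suc p) 0 {minor P 0} z<s (λ _ _ → zeroʳ a))
    other-term (suc zero)    _ i≢1 = contradiction ≡.refl i≢1
    other-term (suc (suc i)) _ _   = trans (*-congˡ (trans (*-congʳ (zeroʳ a)) (zeroˡ _))) (zeroʳ _)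

  -- The weighted cycle

  module CycleDistance (p : ℕ) (w : Fin (suc p) → Carrier) where
    open CyclicSteps p

    weight : Row
    weight i = w (i mod n)

    -- dist (toℕ i) (toℕ j) unfolds to cycleDist R n w i j.
    dist : Matrix
    dist i j = ∑ (steps i j) (λ k → weight (i ℕ.+ k))

    W w₂ : Carrier
    W  = totalWeight R n w
    w₂ = secondSym R n w

    prefix : Row
    prefix j = ∑ j weight

    prefix-total : prefix n ≈ W
    prefix-total = sym (trans (sumFin-cong n weight-toℕ) (sumFin-toℕ n weight))
      where
      weight-toℕ : ∀ i → w i ≈ weight (Fin.toℕ i)
      weight-toℕ i = reflexive (≡.cong w (Finₚ.toℕ-injective (≡.sym (toℕ-mod-< (Finₚ.toℕ<n i)))))

    ∑-rotation : ∀ a → ∑ n (λ k → weight (a ℕ.+ k)) ≈ W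
    ∑-rotation zero    = prefix-total
    ∑-rotation (suc a) = begin
      ∑ n (λ k → weight (suc a ℕ.+ k))   ≈⟨ ∑-cong n (λ k _ → reflexive (≡.cong weight (≡.sym (ℕₚ.+-suc a k)))) ⟩
      ∑ n (λ k → weight (a ℕ.+ suc k))   ≈⟨ ∑-shift-periodic n (λ k → weight (a ℕ.+ k)) (reflexive a+n≡a+0) ⟩
      ∑ n (λ k → weight (a ℕ.+ k))       ≈⟨ ∑-rotation a ⟩
      W                                  ∎
      where
      a+n≡a+0 : weight (a ℕ.+ n) ≡ weight (a ℕ.+ 0)
      a+n≡a+0 = ≡.trans (≡.cong w (mod-periodic a)) (≡.cong weight (≡.sym (ℕₚ.+-identityʳ a)))

    dist-step : ∀ {i j} → suc i < n → j < n → j ≢ i → dist i j ≈ weight i + dist (suc i) j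
    dist-step {i} {j} 1+i<n j<n j≢i = begin
      dist i j                                      ≡⟨ ≡.cong (λ m → ∑ m f) (steps-suc 1+i<n j<n j≢i) ⟩
      ∑ (suc m) f                                   ≈⟨ ∑-front m f ⟩
      weight (i ℕ.+ 0) + ∑ m (λ k → weight (i ℕ.+ suc k))
                                                    ≈⟨ +-cong (reflexive (≡.cong weight (ℕₚ.+-identityʳ i)))
                                                              (∑-cong m (λ k _ → reflexive (≡.cong weight (ℕₚ.+-suc i k)))) ⟩
      weight i + dist (suc i) j                     ∎
      where
      m = steps (suc i) j
      f = λ k → weight (i ℕ.+ k)

    dist-diag : ∀ {i} → i < n → dist i i ≡ 0#
    dist-diag {i} i<n = ≡.cong (λ m → ∑ m (λ k → weight (i ℕ.+ k))) (steps-diag i<n)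

    dist-from-0 : ∀ {j} → j < n → dist 0 j ≡ prefix j
    dist-from-0 j<n = ≡.cong (λ m → ∑ m weight) (steps-from-0 j<n)

    dist-around : ∀ {i} → suc i < n → dist (suc i) i + weight i ≈ W
    dist-around {i} 1+i<n = begin
      dist (suc i) i + weight i                        ≡⟨ ≡.cong₂ (λ m x → ∑ m (λ k → weight (suc i ℕ.+ k)) + x)
                                                            (steps-back 1+i<n) weight-i≡ ⟩
      ∑ p (λ k → weight (suc i ℕ.+ k)) + weight (suc i ℕ.+ p)
                                                       ≈⟨ ∑-rotation (suc i) ⟩
      W                                                ∎
      where
      weight-i≡ : weight i ≡ weight (suc i ℕ.+ p)
      weight-i≡ = ≡.trans (≡.cong w (≡.sym (mod-periodic i))) (≡.cong weight (ℕₚ.+-suc i p))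

    dist-difference : ∀ {i j} → i < p → j < n → W * δ j i - weight i ≈ dist (suc i) j - dist i j
    dist-difference {i} {j} i<p j<n with j ≟ i
    ... | yes ≡.refl = begin
      W * δ j j - weight j          ≈⟨ +-congʳ (trans (*-congˡ (reflexive (δ-diag j))) (*-identityʳ W)) ⟩
      W - weight j                  ≈⟨ x≈z//y _ _ _ (dist-around (s≤s i<p)) ⟨
      dist (suc j) j                ≈⟨ +-identityʳ _ ⟨
      dist (suc j) j + 0#           ≈⟨ +-congˡ (trans (-‿cong (reflexive (dist-diag (ℕₚ.m<n⇒m<1+n i<p)))) -0#≈0#) ⟨
      dist (suc j) j - dist j j     ∎
    ... | no j≢i = begin
      W * δ j i - weight i                          ≈⟨ +-congʳ (trans (*-congˡ (reflexive (δ-off-diag j≢i))) (zeroʳ W)) ⟩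
      0# - weight i                                 ≈⟨ +-identityˡ _ ⟩
      - weight i                                    ≈⟨ y-[x+y]≈-x (weight i) (dist (suc i) j) ⟨
      dist (suc i) j - (weight i + dist (suc i) j)  ≈⟨ +-congˡ (-‿cong (dist-step (s≤s i<p) j<n j≢i)) ⟨
      dist (suc i) j - dist i j                     ∎

    -- Row i+1 is row i+1 minus row i of dist; the first row is left free.
    reduced : Row → Matrix
    reduced x zero    j = x j
    reduced x (suc i) j = W * δ j i - weight i

    det-dist : detℕ n dist ≈ detℕ n (reduced prefix)
    det-dist = sym (detℕ-successive-differences p {dist} {reduced prefix}
      (λ j j<n → reflexive (≡.sym (dist-from-0 j<n))) (λ i j i<p j<n → dist-difference i<p j<n))

    w₂≈∑prefix*weight : w₂ ≈ ∑ n (λ k → prefix k * weight k)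
    w₂≈∑prefix*weight = ∑-cong n (λ k _ → sym (*-distribʳ-∑ k (weight k) weight))

    coefficient : Row
    coefficient k = prefix k - prefix p

    ∑-coefficient*δ : ∀ {j} → j < n → ∑ p (λ k → coefficient k * δ j k) ≈ coefficient j
    ∑-coefficient*δ {j} j<n with ℕₚ.m<1+n⇒m<n∨m≡n j<n
    ... | inj₁ j<p    = ∑-δ p j coefficient j<p
    ... | inj₂ ≡.refl = trans (∑-zero p (λ k k<p →
      trans (*-congˡ (reflexive (δ-off-diag (ℕₚ.<⇒≢ k<p ∘ ≡.sym)))) (zeroʳ _))) (sym (-‿inverseʳ (prefix p)))

    ∑-coefficient*weight : ∑ p (λ k → coefficient k * weight k) ≈ ∑ p (λ k → prefix k * weight k) - prefix p * prefix p
    ∑-coefficient*weight = begin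
      ∑ p (λ k → coefficient k * weight k)
        ≈⟨ ∑-cong p (λ k _ → [y-z]x≈yx-zx (weight k) (prefix k) (prefix p)) ⟩
      ∑ p (λ k → prefix k * weight k - prefix p * weight k)
        ≈⟨ ∑-distrib-+ p _ _ ⟩
      ∑ p (λ k → prefix k * weight k) + ∑ p (λ k → - (prefix p * weight k))
        ≈⟨ +-congˡ (-‿distrib-∑ p _) ⟨
      ∑ p (λ k → prefix k * weight k) - ∑ p (λ k → prefix p * weight k)
        ≈⟨ +-congˡ (-‿cong (*-distribˡ-∑ p (prefix p) weight)) ⟨
      ∑ p (λ k → prefix k * weight k) - prefix p * prefix p ∎

    first-row-dependency : ∀ {j} → j < n →
      W * prefix j - w₂ ≈ ∑ p (λ k → coefficient k * (W * δ j k - weight k))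
    first-row-dependency {j} j<n = sym (begin
      ∑ p (λ k → coefficient k * (W * δ j k - weight k))
        ≈⟨ ∑-cong p (λ k _ → trans (x[y-z]≈xy-xz _ _ _) (+-congʳ (x∙yz≈y∙xz _ W _))) ⟩
      ∑ p (λ k → W * (coefficient k * δ j k) - coefficient k * weight k)
        ≈⟨ ∑-distrib-+ p _ _ ⟩
      ∑ p (λ k → W * (coefficient k * δ j k)) + ∑ p (λ k → - (coefficient k * weight k))
        ≈⟨ +-cong (*-distribˡ-∑ p W _) (-‿distrib-∑ p _) ⟨
      W * ∑ p (λ k → coefficient k * δ j k) - ∑ p (λ k → coefficient k * weight k)
        ≈⟨ +-cong (*-congˡ (∑-coefficient*δ j<n)) (-‿cong ∑-coefficient*weight) ⟩
      W * coefficient j - (∑ p (λ k → prefix k * weight k) - prefix p * prefix p)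
        ≈⟨ x[t-s]-[a-s²]≈xt-[a+su] (prefix j) _ (sym prefix-total) ⟩
      W * prefix j - ∑ n (λ k → prefix k * weight k)
        ≈⟨ +-congˡ (-‿cong w₂≈∑prefix*weight) ⟨
      W * prefix j - w₂ ∎)

    W*det-reduced-prefix : W * detℕ n (reduced prefix) ≈ w₂ * detℕ n (reduced ones)
    W*det-reduced-prefix = begin
      W * detℕ n (reduced prefix)         ≈⟨ +-inverseˡ-unique _ _ linear-combination≈0 ⟩
      - (- w₂ * detℕ n (reduced ones))    ≈⟨ -‿cong (-‿distribˡ-* w₂ _) ⟨
      - - (w₂ * detℕ n (reduced ones))    ≈⟨ -‿involutive _ ⟩
      w₂ * detℕ n (reduced ones)          ∎
      where
      y : Row
      y j = W * prefix j - w₂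
      linear-combination≈0 : W * detℕ n (reduced prefix) + - w₂ * detℕ n (reduced ones) ≈ 0#
      linear-combination≈0 = begin
        W * detℕ n (reduced prefix) + - w₂ * detℕ n (reduced ones)
          ≈⟨ detℕ-linear n 0 W (- w₂) {reduced prefix} {reduced ones} {reduced y} z<s same same
               (λ j _ → +-congˡ (sym (*-identityʳ _))) ⟨
        detℕ n (reduced y)
          ≈⟨ detℕ-first-row-combination p n {reduced y} coefficient ℕₚ.≤-refl (λ j → first-row-dependency) ⟩
        0# ∎
        where
        same : ∀ {x} i j → i < n → j < n → i ≢ 0 → reduced x i j ≈ reduced y i j
        same zero    j _ _ i≢0 = contradiction ≡.refl i≢0
        same (suc i) j _ _ _   = refl

    det-reduced-ones : detℕ n (reduced ones) ≈ pow R (- W) p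
    det-reduced-ones = begin
      detℕ n (reduced ones)                ≈⟨ detℕ-add-multiples-of-first-row p {reduced ones} {onesAboveScaledIdentity W}
                                                weight (λ _ _ → refl) (λ i j _ _ → sym ([x-y]+y*1≈x _ _)) ⟨
      detℕ n (onesAboveScaledIdentity W)   ≈⟨ detℕ-onesAboveScaledIdentity p W ⟩
      pow R (- W) p                        ∎
      where
      [x-y]+y*1≈x : ∀ x y → (x - y) + y * 1# ≈ x
      [x-y]+y*1≈x x y = trans (+-congˡ (*-identityʳ y)) ([x-y]+y≈x x y)

    W*det-dist : W * detℕ n dist ≈ w₂ * pow R (- W) p
    W*det-dist = begin
      W * detℕ n dist               ≈⟨ *-congˡ det-dist ⟩
      W * detℕ n (reduced prefix)   ≈⟨ W*det-reduced-prefix ⟩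
      w₂ * detℕ n (reduced ones)    ≈⟨ *-congˡ det-reduced-ones ⟩
      w₂ * pow R (- W) p            ∎

lemma4p2 : {c ℓ : Level} (R : CommutativeRing c ℓ) (n : ℕ) .{{_ : NonZero n}} → 2 ≤ n →
    (w : Fin n → CommutativeRing.Carrier R) →
    isUnit R (totalWeight R n w) →
    CommutativeRing._≈_ R (det R n (cycleDist R n w))
      (CommutativeRing._*_ R (pow R (CommutativeRing.-_ R (CommutativeRing.1# R)) (n ∸ 1))
        (CommutativeRing._*_ R (pow R (totalWeight R n w) (n ∸ 2)) (secondSym R n w)))
lemma4p2 R (suc (suc q)) (s≤s (s≤s z≤n)) w W-unit = begin
  det R n (cycleDist R n w)             ≈⟨ det≈detℕ n {N = dist} (λ _ _ → refl) ⟩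
  detℕ n dist                           ≈⟨ unit-cancelˡ W-unit (begin
    W * detℕ n dist                         ≈⟨ W*det-dist ⟩
    w₂ * pow R (- W) (suc q)                ≈⟨ *-congˡ (pow-neg W (suc q)) ⟩
    w₂ * (sign (suc q) * (W * pow R W q))   ≈⟨ x∙yz≈y∙xz _ _ _ ⟩
    sign (suc q) * (w₂ * (W * pow R W q))   ≈⟨ *-congˡ (x∙yz≈y∙xz _ _ _) ⟩
    sign (suc q) * (W * (w₂ * pow R W q))   ≈⟨ x∙yz≈y∙xz _ _ _ ⟩
    W * (sign (suc q) * (w₂ * pow R W q))   ≈⟨ *-congˡ (*-congˡ (*-comm _ _)) ⟩
    W * (sign (suc q) * (pow R W q * w₂))   ∎) ⟩
  sign (suc q) * (pow R W q * w₂)       ∎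
  where
  open CommutativeRing R
  open CycleDeterminant R
  open CycleDistance (suc q) w
  open CyclicSteps (suc q) using (n)
  open import Algebra.Properties.CommutativeSemigroup *-commutativeSemigroup using (x∙yz≈y∙xz)
  open import Relation.Binary.Reasoning.Setoid setoid
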